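{- For all $n\ge1$ and $a,b\in\mathbb{R}$, \[ S_n(2,1;t)\,S_n(a,b;t)-S_{n-1}(2,1;t)\,S_{n+1}(a,b;t)=t^{2n}. \]
   Context: For $a,b\in\mathbb{R}$ the polynomials $S_n(a,b;t)$ in the variable $t$ are defined by $S_0(a,b;t)=1$, $S_1(a,b;t)=at+b$, and $S_n(a,b;t)=(1+2t)S_{n-1}(a,b;t)-t^2S_{n-2}(a,b;t)$ for $n\ge2$. -}

module Defs where

open import Level using (Level)
open import Data.Nat using (ℕ; zero; suc)
open import Algebra.Bundles using (CommutativeRing)

module _ {c ℓ : Level} (R : CommutativeRing c ℓ) where
  open CommutativeRing R

  pow : Carrier → ℕ → Carrier
  pow t zero    = 1#
  pow t (suc n) = t * pow t n

  S : Carrier → Carrier → Carrier → ℕ → Carrier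
  S a b t zero          = 1#
  S a b t (suc zero)    = a * t + b
  S a b t (suc (suc n)) =
    (1# + (1# + 1#) * t) * S a b t (suc n) - (t * t) * S a b t n

-- Both S(2,1;·) and S(a,b;·) solve x (n+2) = (1+2t) x (n+1) − t² x n. For any two solutions x, y
-- of a recurrence x (n+2) = p x (n+1) − q x n, the cross term x (n+1) y (n+1) − x n y (n+2) is
-- multiplied by q at each step. At n = 0 it equals t², since S_0 = 1 and S_1(2,1;t) = 1 + 2t;
-- hence it equals t^(2n+2).
module Submission where

open import Level using (Level)
open import Data.Nat using (ℕ; zero; suc; _∸_; _≤_; s≤s; z≤n; _*_)
open import Data.Nat.Properties using (*-suc)
open import Relation.Binary.PropositionalEquality using (cong)
open import Algebra.Bundles using (CommutativeRing)
import Algebra.Properties.Group as GroupProperties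
import Algebra.Properties.Ring as RingProperties
import Algebra.Solver.Ring.NaturalCoefficients.Default as SemiringSolver
open import Defs

module ThreeTermRecurrence {c ℓ : Level} (R : CommutativeRing c ℓ) where
  open CommutativeRing R renaming (_*_ to _·_)
  open GroupProperties +-group using (//-rightDividesˡ; //-rightDividesʳ)
  open RingProperties ring using (x[y-z]≈xy-xz)
  open SemiringSolver commutativeSemiring using (solve; _:=_; _:+_; _:*_)
  open import Relation.Binary.Reasoning.Setoid setoid

  x≈z+y⇒x-y≈z : ∀ {x y z} → x ≈ z + y → x - y ≈ z
  x≈z+y⇒x-y≈z {x} {y} {z} x≈z+y = trans (+-congʳ x≈z+y) (//-rightDividesʳ y z)

  x+v≈u+y⇒x-y≈u-v : ∀ {x y u v} → x + v ≈ u + y → x - y ≈ u - v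
  x+v≈u+y⇒x-y≈u-v {x} {y} {u} {v} x+v≈u+y = x≈z+y⇒x-y≈z (begin
    x                ≈⟨ //-rightDividesʳ v x ⟨
    x + v - v        ≈⟨ +-congʳ x+v≈u+y ⟩
    u + y - v        ≈⟨ +-assoc u y (- v) ⟩
    u + (y - v)      ≈⟨ +-congˡ (+-comm y (- v)) ⟩
    u + (- v + y)    ≈⟨ +-assoc u (- v) y ⟨
    u - v + y        ∎)

  -- Stated without subtraction, so that it can be used with a semiring solver.
  Solves : Carrier → Carrier → (ℕ → Carrier) → Set ℓ
  Solves p q x = ∀ n → x (suc (suc n)) + q · x n ≈ p · x (suc n)

  cross : (ℕ → Carrier) → (ℕ → Carrier) → ℕ → Carrier
  cross x y n = x (suc n) · y (suc n) - x n · y (suc (suc n))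

  cross-zero : ∀ {p q x y} → Solves p q y → x 0 ≈ 1# → x 1 ≈ p → y 0 ≈ 1# → cross x y 0 ≈ q
  cross-zero {p} {q} {x} {y} sy x₀≈1 x₁≈p y₀≈1 = x≈z+y⇒x-y≈z (begin
    x 1 · y 1        ≈⟨ *-congʳ x₁≈p ⟩
    p · y 1          ≈⟨ sy 0 ⟨
    y 2 + q · y 0    ≈⟨ +-comm (y 2) (q · y 0) ⟩
    q · y 0 + y 2    ≈⟨ +-cong (trans (*-congˡ y₀≈1) (*-identityʳ q))
                               (sym (trans (*-congʳ x₀≈1) (*-identityˡ (y 2)))) ⟩
    q + x 0 · y 2    ∎)

  cross-suc : ∀ {p q x y} → Solves p q x → Solves p q y →
              ∀ n → cross x y (suc n) ≈ q · cross x y n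
  -- Adding q x₀ y₂ and q x₁ y₁ to the two products turns each into p x₁ y₂.
  cross-suc {p} {q} {x} {y} sx sy n = begin
    x₂ · y₂ - x₁ · y₃
      ≈⟨ x+v≈u+y⇒x-y≈u-v (begin
           x₂ · y₂ + q · x₀ · y₂      ≈⟨ distribʳ y₂ x₂ (q · x₀) ⟨
           (x₂ + q · x₀) · y₂         ≈⟨ *-congʳ (sx n) ⟩
           p · x₁ · y₂                ≈⟨ rearrange p x₁ y₂ ⟩
           x₁ · (p · y₂)              ≈⟨ *-congˡ (sy (suc n)) ⟨
           x₁ · (y₃ + q · y₁)         ≈⟨ distribute q x₁ y₁ y₃ ⟩
           q · x₁ · y₁ + x₁ · y₃      ∎) ⟩
    q · x₁ · y₁ - q · x₀ · y₂         ≈⟨ +-cong (*-assoc q x₁ y₁) (-‿cong (*-assoc q x₀ y₂)) ⟩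
    q · (x₁ · y₁) - q · (x₀ · y₂)     ≈⟨ x[y-z]≈xy-xz q _ _ ⟨
    q · cross x y n                   ∎
    where
    x₀ = x n
    x₁ = x (suc n)
    x₂ = x (suc (suc n))
    y₁ = y (suc n)
    y₂ = y (suc (suc n))
    y₃ = y (suc (suc (suc n)))
    rearrange : ∀ a b d → a · b · d ≈ b · (a · d)
    rearrange = solve 3 (λ a b d → a :* b :* d := b :* (a :* d)) refl
    distribute : ∀ a b d e → b · (e + a · d) ≈ a · b · d + b · e
    distribute = solve 4 (λ a b d e → b :* (e :+ a :* d) := a :* b :* d :+ b :* e) refl

  cross-closed : ∀ {p q x y} → Solves p q x → Solves p q y →
                 ∀ n → cross x y n ≈ pow R q n · cross x y 0
  cross-closed sx sy zero = sym (*-identityˡ _)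
  cross-closed {q = q} {x} {y} sx sy (suc n) = begin
    cross x y (suc n)              ≈⟨ cross-suc sx sy n ⟩
    q · cross x y n                ≈⟨ *-congˡ (cross-closed sx sy n) ⟩
    q · (pow R q n · cross x y 0)  ≈⟨ *-assoc q _ _ ⟨
    pow R q (suc n) · cross x y 0  ∎

  pow-double : ∀ t n → pow R t (2 * n) ≈ pow R (t · t) n
  pow-double t zero    = refl
  pow-double t (suc n) = begin
    pow R t (2 * suc n)        ≡⟨ cong (pow R t) (*-suc 2 n) ⟩
    t · (t · pow R t (2 * n))  ≈⟨ *-assoc t t _ ⟨
    t · t · pow R t (2 * n)    ≈⟨ *-congˡ (pow-double t n) ⟩
    pow R (t · t) (suc n)      ∎

  S-solves : ∀ a b t → Solves (1# + (1# + 1#) · t) (t · t) (S R a b t)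
  S-solves a b t n = //-rightDividesˡ _ _

  S-cross-zero : ∀ a b t → cross (S R (1# + 1#) 1# t) (S R a b t) 0 ≈ t · t
  S-cross-zero a b t = cross-zero {x = S R (1# + 1#) 1# t} (S-solves a b t) refl (+-comm _ _) refl

lemma2p4 : ∀ {c ℓ : Level} (R : CommutativeRing c ℓ) (n : ℕ) → 1 ≤ n →
    (a b t : CommutativeRing.Carrier R) →
    CommutativeRing._≈_ R
    (CommutativeRing._-_ R
    (CommutativeRing._*_ R (S R (CommutativeRing._+_ R (CommutativeRing.1# R) (CommutativeRing.1# R)) (CommutativeRing.1# R) t n) (S R a b t n))
    (CommutativeRing._*_ R (S R (CommutativeRing._+_ R (CommutativeRing.1# R) (CommutativeRing.1# R)) (CommutativeRing.1# R) t (n ∸ 1)) (S R a b t (suc n))))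
    (pow R t (2 * n))
lemma2p4 R (suc n) (s≤s z≤n) a b t = begin
  cross (S R (1# + 1#) 1# t) (S R a b t) n
    ≈⟨ cross-closed (S-solves (1# + 1#) 1# t) (S-solves a b t) n ⟩
  pow R (t · t) n · cross (S R (1# + 1#) 1# t) (S R a b t) 0
    ≈⟨ *-congˡ (S-cross-zero a b t) ⟩
  pow R (t · t) n · (t · t)
    ≈⟨ *-comm _ _ ⟩
  pow R (t · t) (suc n)
    ≈⟨ pow-double t (suc n) ⟨
  pow R t (2 * suc n)  ∎
  where
  open CommutativeRing R renaming (_*_ to _·_)
  open ThreeTermRecurrence R
  open import Relation.Binary.Reasoning.Setoid setoid
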